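{- There is an absolute constant $c>0$ such that the following holds. Let $\delta>0$, let $q\geq 1$, and let $T$ be an $N$-vertex tournament that is $\delta$-far from transitive, whose edges are colored with $q$ colors. Then $T$ contains a directed path with at least $c\delta^2N/q^3$ vertices whose edges are colored by at most three colors. Furthermore, there exist distinct vertices $v_1,\dots,v_L$ with $L\geq c\delta^2N/q^3$ such that $v_i\to v_{i+1}$ for all $1\leq i<L$, $v_{i+2}\to v_i$ for all $1\leq i\leq L-2$, and the coloring of these edges is periodic with period $3$: the color of the edge $v_iv_{i+1}$ depends only on $i \bmod 3$, and the color of the edge $v_iv_{i+2}$ depends only on $i\bmod 3$.
   Context: An $N$-vertex tournament is $\delta$-close to transitive if it can be made transitive by reversing the orientation of at most $\delta N^2$ edges, and $\delta$-far from transitive otherwise. $u\to w$ means the edge between $u$ and $w$ is oriented from $u$ to $w$.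
   Formalization: The parameter δ ranges over the positive rationals, and the absolute constant c is taken in the rationals. -}

module Defs where

open import Data.Nat as ℕ using (ℕ; zero; suc; _%_)
open import Data.Integer using (+_)
open import Data.Rational as ℚ using (ℚ; _/_; _*_; _≤_; _<_; 0ℚ)
open import Data.Fin using (Fin)
open import Data.Bool using (Bool; true; false; if_then_else_)
open import Data.List using (List; map)
open import Data.Nat.ListAction using (sum)
open import Data.List using (allFin) public
open import Data.Product using (Σ; _×_; ∃; ∃-syntax)
open import Relation.Binary.PropositionalEquality using (_≡_; _≢_)
open import Relation.Nullary using (¬_)

⟦_⟧ : ℕ → ℚ
⟦ n ⟧ = (+ n) / 1

-- A directed graph on vertex set Fin N, given by its (Boolean) adjacency:
-- adj u w ≡ true  means  u → w.
Orientation : ℕ → Set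
Orientation N = Fin N → Fin N → Bool

IsTournament : ∀ {N} → Orientation N → Set
IsTournament {N} T =
  (∀ (u : Fin N) → T u u ≡ false) ×
  (∀ (u w : Fin N) → u ≢ w → T u w ≢ T w u)

IsTransitive : ∀ {N} → Orientation N → Set
IsTransitive {N} T =
  ∀ (u v w : Fin N) → T u v ≡ true → T v w ≡ true → T u w ≡ true

-- Number of edges of T that are reversed in T' : ordered pairs (u,w) with
-- u → w in T but not in T'.  For two tournaments, each edge whose
-- orientation differs is counted exactly once.
reversals : ∀ {N} → Orientation N → Orientation N → ℕ
reversals {N} T T' =
  sum (map (λ u → sum (map (λ w → if T u w then (if T' u w then 0 else 1) else 0)
                           (allFin N)))
           (allFin N))

DeltaClose : ∀ {N} → ℚ → Orientation N → Set
DeltaClose {N} δ T =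
  ∃[ T' ] (IsTournament T' × IsTransitive T' ×
           ⟦ reversals T T' ⟧ ≤ δ * ⟦ N ℕ.* N ⟧)

DeltaFar : ∀ {N} → ℚ → Orientation N → Set
DeltaFar δ T = ¬ DeltaClose δ T

Colouring : ℕ → ℕ → Set
Colouring N q = Fin N → Fin N → Fin q

IsEdgeColouring : ∀ {N q} → Colouring N q → Set
IsEdgeColouring {N} col = ∀ (u w : Fin N) → col u w ≡ col w u

Distinct : ∀ {N} → ℕ → (ℕ → Fin N) → Set
Distinct L v = ∀ i j → i ℕ.< L → j ℕ.< L → v i ≡ v j → i ≡ j

IsDirectedPath : ∀ {N} → Orientation N → ℕ → (ℕ → Fin N) → Set
IsDirectedPath T L v =
  Distinct L v × (∀ i → suc i ℕ.< L → T (v i) (v (suc i)) ≡ true)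

AtMostThreeColours : ∀ {N q} → Colouring N q → ℕ → (ℕ → Fin N) → Set
AtMostThreeColours {q = q} col L v =
  Σ (Fin 3 → Fin q) λ S →
    ∀ i → suc i ℕ.< L → Σ (Fin 3) λ k → col (v i) (v (suc i)) ≡ S k

{-# OPTIONS --safe #-}
-- Order the vertices by decreasing out-degree.  This ordering is a transitive tournament, so
-- δ-farness gives B > δN² edges of T pointing backwards.  A backward edge u → w has
-- outdeg u ≤ outdeg w, so it lies on more cyclic triangles u → w → x → u than there are backward
-- edges u → x with x → w.  Summed over the b(u) backward edges at u this gives b(u)² ≤ 2 t(u) for
-- the number t(u) of cyclic triangles at u, and Cauchy–Schwarz gives B² ≤ 2N·t, t = Σ t(u).
-- By pigeonhole one colour pattern (a₀, a₁, a₂) is shared by S ≥ t/q³ of these triangles.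
-- Repeatedly deleting a pattern triangle two of whose vertices lie in fewer than k pattern
-- triangles removes at most 3N²k triangles, so for k ≈ S/3N² a nonempty family survives in which
-- every such pair extends in at least k ways.  Growing a sequence greedily through it gives L ≥ k
-- distinct vertices in which any three consecutive ones form a pattern triangle, rotated according
-- to the position mod 3.  Altogether B² ≤ 12N³Lq³, i.e. δ²N/12 ≤ Lq³.
module Submission where

open import Defs

module Combinatorial where

  open import Data.Bool using (Bool; true; false; if_then_else_; _∧_; not)
  import Data.Bool.Properties as Boolₚ
  open import Data.Bool.Properties using (¬-not; ∧-zeroʳ; ∧-commutativeMonoid)
  open import Data.Empty using (⊥-elim)
  open import Data.Fin as Fin using (Fin; zero; suc; _≟_)
  import Data.Fin.Properties as Finₚ
  import Data.List as List using (map; tabulate; allFin)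
  import Data.List.Properties as Listₚ
  import Data.Nat.ListAction as List
  open import Data.Nat
    using (ℕ; NonZero; >-nonZero; zero; suc; _^_; _+_; _*_; _∸_; _≤_; _<_; _>_; _⊓_; _%_; _/_; z≤n; s≤s; z<s)
  open import Data.Nat.DivMod using (m≡m%n+[m/n]*n; m/n*n≤m; m%n<n)
  open import Data.Nat.Properties hiding (_≟_)
  open import Data.Nat.Tactic.RingSolver using (solve-∀)
  open import Data.Product using (_×_; _,_; proj₁; proj₂; ∃-syntax; uncurry)
  open import Data.Product.Relation.Binary.Lex.Strict using (×-Lex; ×-isStrictTotalOrder)
  open import Data.Product.Relation.Binary.Pointwise.NonDependent using (Pointwise)
  open import Data.Sum using (inj₁; inj₂; [_,_]′)
  open import Data.Vec.Functional using ([]; _∷_)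
  open import Function using (id; _∘_; _∘′_; _on_)
  open import Level using (0ℓ)
  open import Relation.Binary using (Rel; IsStrictTotalOrder; tri<; tri≈; tri>)
  import Relation.Binary.Construct.Flip.EqAndOrd as Flip
  import Relation.Binary.Construct.On as On
  open import Relation.Binary.PropositionalEquality
  open import Relation.Nullary using (¬_; Dec; does; yes; no)
  open import Relation.Nullary.Decidable using (dec-true; dec-false; _×-dec_)
  open import Algebra.Bundles using (CommutativeMonoid)
  open import Algebra.Properties.CommutativeSemigroup +-commutativeSemigroup using (xy∙z≈xz∙y)
  open import Algebra.Properties.CommutativeSemigroup (CommutativeMonoid.commutativeSemigroup ∧-commutativeMonoid)
    using (x∙yz≈y∙xz)
  open import Algebra.Properties.Semiring.Sum +-*-semiring
    using (sum; sum-syntax; ∑-distrib-+; ∑-comm; sum-cong-≗; *-distribˡ-sum; *-distribʳ-sum; sum-replicate-zero)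

  -- Finite sums and counting

  does≡true⇒ : ∀ {P : Set} (p? : Dec P) → does p? ≡ true → P
  does≡true⇒ (yes p) _ = p

  not-does≡true⇒¬ : ∀ {P : Set} (p? : Dec P) → not (does p?) ≡ true → ¬ P
  not-does≡true⇒¬ (no ¬p) _ = ¬p

  ∧≡true⇒ : ∀ {x y} → x ∧ y ≡ true → x ≡ true × y ≡ true
  ∧≡true⇒ {true} {true} _ = refl , refl

  𝟙 : Bool → ℕ
  𝟙 b = if b then 1 else 0

  𝟙-mono : ∀ {x y} → (x ≡ true → y ≡ true) → 𝟙 x ≤ 𝟙 y
  𝟙-mono {false} _   = z≤n
  𝟙-mono {true}  x⇒y rewrite x⇒y refl = ≤-refl

  𝟙>0⇒≡true : ∀ {b} → 0 < 𝟙 b → b ≡ true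
  𝟙>0⇒≡true {true} _ = refl

  ∑-mono-≤ : ∀ {n} {f g : Fin n → ℕ} → (∀ i → f i ≤ g i) → sum f ≤ sum g
  ∑-mono-≤ {zero}  f≤g = z≤n
  ∑-mono-≤ {suc n} f≤g = +-mono-≤ (f≤g zero) (∑-mono-≤ (λ i → f≤g (suc i)))

  ∑-mono-< : ∀ {n} {f g : Fin n → ℕ} → (∀ i → f i ≤ g i) → ∀ i → f i < g i → sum f < sum g
  ∑-mono-< f≤g zero    fi<gi = +-mono-<-≤ fi<gi (∑-mono-≤ (λ i → f≤g (suc i)))
  ∑-mono-< f≤g (suc i) fi<gi = +-mono-≤-< (f≤g zero) (∑-mono-< (λ j → f≤g (suc j)) i fi<gi)

  ∑≤n*c : ∀ {n} {f : Fin n → ℕ} c → (∀ i → f i ≤ c) → sum f ≤ n * c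
  ∑≤n*c {zero}  c f≤c = z≤n
  ∑≤n*c {suc n} c f≤c = +-mono-≤ (f≤c zero) (∑≤n*c c (λ i → f≤c (suc i)))

  ∑>0⇒∃>0 : ∀ {n} (f : Fin n → ℕ) → 0 < sum f → ∃[ i ] 0 < f i
  ∑>0⇒∃>0 {suc n} f ∑f>0 with f zero in eq
  ... | suc _ = zero , subst (0 <_) (sym eq) (s≤s z≤n)
  ... | zero  = let i , fi>0 = ∑>0⇒∃>0 (λ i → f (suc i)) ∑f>0 in suc i , fi>0

  ∑-distrib-+³ : ∀ {n} (f g h : Fin n → ℕ) → ∑[ i < n ] (f i + g i + h i) ≡ sum f + sum g + sum h
  ∑-distrib-+³ f g h = trans (∑-distrib-+ (λ i → f i + g i) h) (cong (_+ sum h) (∑-distrib-+ f g))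

  ∑-update : ∀ {n} {f g : Fin n → ℕ} i₀ d →
             (∀ i → i ≢ i₀ → f i ≡ g i) → f i₀ + d ≡ g i₀ → sum f + d ≡ sum g
  ∑-update {suc n} {f} {g} zero d f≗g fi₀+d≡gi₀ =
    trans (xy∙z≈xz∙y (f zero) _ d) (cong₂ _+_ fi₀+d≡gi₀ (sum-cong-≗ (λ i → f≗g (suc i) λ ())))
  ∑-update {suc n} {f} {g} (suc i₀) d f≗g fi₀+d≡gi₀ =
    trans (+-assoc (f zero) _ d)
          (cong₂ _+_ (f≗g zero λ ())
                     (∑-update i₀ d (λ i i≢i₀ → f≗g (suc i) (i≢i₀ ∘ Finₚ.suc-injective)) fi₀+d≡gi₀))

  ∑-𝟙-≟ : ∀ {n} (w : Fin n) → ∑[ x < n ] 𝟙 (does (x ≟ w)) ≡ 1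
  ∑-𝟙-≟ {suc n} zero    = cong suc (sum-replicate-zero n)
  ∑-𝟙-≟ {suc n} (suc w) = ∑-𝟙-≟ w

  2xy≤x²+y² : ∀ x y → 2 * (x * y) ≤ x * x + y * y
  2xy≤x²+y² x y = [ ordered , swapped ]′ (≤-total x y)
    where
    square-of-sum : ∀ x d → 2 * (x * (x + d)) + d * d ≡ x * x + (x + d) * (x + d)
    square-of-sum = solve-∀
    ordered : ∀ {x y} → x ≤ y → 2 * (x * y) ≤ x * x + y * y
    ordered {x} x≤y with m≤n⇒∃[o]m+o≡n x≤y
    ... | d , refl = ≤-trans (m≤m+n _ (d * d)) (≤-reflexive (square-of-sum x d))
    swapped : y ≤ x → 2 * (x * y) ≤ x * x + y * y
    swapped y≤x = subst₂ _≤_ (cong (2 *_) (*-comm y x)) (+-comm (y * y) (x * x)) (ordered y≤x)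

  cauchy-schwarz : ∀ {n} (f : Fin n → ℕ) → sum f * sum f ≤ n * ∑[ i < n ] (f i * f i)
  cauchy-schwarz {zero}  f = z≤n
  cauchy-schwarz {suc n} f = begin
    (a + S) * (a + S)                  ≡⟨ expand a S ⟩
    a * a + 2 * (a * S) + S * S        ≤⟨ +-mono-≤ (+-monoʳ-≤ (a * a) cross-term) (cauchy-schwarz f′) ⟩
    a * a + (n * (a * a) + Q) + n * Q  ≡⟨ collect a n Q ⟩
    suc n * (a * a + Q)                ∎
    where
    open ≤-Reasoning
    a  = f zero
    f′ = λ i → f (suc i)
    S  = sum f′
    Q  = ∑[ i < n ] (f′ i * f′ i)
    expand : ∀ a S → (a + S) * (a + S) ≡ a * a + 2 * (a * S) + S * S
    expand = solve-∀
    collect : ∀ a n Q → a * a + (n * (a * a) + Q) + n * Q ≡ suc n * (a * a + Q)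
    collect = solve-∀
    cross-term : 2 * (a * S) ≤ n * (a * a) + Q
    cross-term = begin
      2 * (a * S)                       ≡⟨ cong (2 *_) (*-distribˡ-sum a f′) ⟩
      2 * ∑[ i < n ] (a * f′ i)         ≡⟨ *-distribˡ-sum 2 (λ i → a * f′ i) ⟩
      ∑[ i < n ] (2 * (a * f′ i))       ≤⟨ ∑-mono-≤ (λ i → 2xy≤x²+y² a (f′ i)) ⟩
      ∑[ i < n ] (a * a + f′ i * f′ i)  ≡⟨ ∑-distrib-+ (λ _ → a * a) (λ i → f′ i * f′ i) ⟩
      ∑[ i < n ] (a * a) + Q            ≤⟨ +-monoˡ-≤ Q (∑≤n*c {n} (a * a) (λ _ → ≤-refl)) ⟩
      n * (a * a) + Q                   ∎

  argmax : ∀ {n} → 0 < n → (f : Fin n → ℕ) → ∃[ i ] (∀ j → f j ≤ f i)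
  argmax {suc zero}    _ f = zero , λ { zero → ≤-refl }
  argmax {suc (suc n)} _ f with argmax {suc n} (s≤s z≤n) (λ i → f (suc i))
  ... | i , f′≤fi with f zero ≤? f (suc i)
  ...   | yes f0≤fi = suc i , λ { zero → f0≤fi ; (suc j) → f′≤fi j }
  ...   | no  f0≰fi = zero , λ { zero → ≤-refl ; (suc j) → ≤-trans (f′≤fi j) (<⇒≤ (≰⇒> f0≰fi)) }

  ∑-pigeonhole : ∀ {n} → 0 < n → (f : Fin n → ℕ) → ∃[ i ] sum f ≤ n * f i
  ∑-pigeonhole n>0 f = let i , f≤fi = argmax n>0 f in i , ∑≤n*c (f i) f≤fi

  m<n∸o⇒o+m<n : ∀ {m} n o → m < n ∸ o → o + m < n
  m<n∸o⇒o+m<n n       zero    m<n   = m<n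
  m<n∸o⇒o+m<n (suc n) (suc o) m<n∸o = s≤s (m<n∸o⇒o+m<n n o m<n∸o)

  *-pos : ∀ m n → 0 < m * n → 0 < m × 0 < n
  *-pos (suc m) (suc n) _ = z<s , z<s
  *-pos (suc m) zero    mn>0 = ⊥-elim (<-irrefl (sym (*-zeroʳ m)) mn>0)

  division-threshold : ∀ d S .{{_ : NonZero d}} → 0 < S → d * ((S ∸ 1) / d) < S × S ≤ d * suc ((S ∸ 1) / d)
  division-threshold d (suc m) _ = s≤s (subst (_≤ m) (*-comm (m / d) d) (m/n*n≤m m d)) , m<d[1+m/d]
    where
    open ≤-Reasoning
    m<d[1+m/d] : m < d * suc (m / d)
    m<d[1+m/d] = begin-strict
      m                  ≡⟨ m≡m%n+[m/n]*n m d ⟩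
      m % d + m / d * d  <⟨ +-monoˡ-< (m / d * d) (m%n<n m d) ⟩
      d + m / d * d      ≡⟨ *-comm (suc (m / d)) d ⟩
      d * suc (m / d)    ∎

  sum-tabulate : ∀ {n} (f : Fin n → ℕ) → List.sum (List.tabulate f) ≡ sum f
  sum-tabulate {zero}  f = refl
  sum-tabulate {suc n} f = cong (f zero +_) (sum-tabulate (f ∘ suc))

  sum-map-allFin : ∀ n (f : Fin n → ℕ) → List.sum (List.map f (List.allFin n)) ≡ sum f
  sum-map-allFin n f = trans (cong List.sum (Listₚ.map-tabulate id f)) (sum-tabulate f)

  ∑-comm³ : ∀ {l m n o} (F : Fin l → Fin m → Fin n → Fin o → ℕ) →
            ∑[ x < l ] ∑[ y < m ] ∑[ z < n ] ∑[ a < o ] F x y z a ≡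
            ∑[ a < o ] ∑[ x < l ] ∑[ y < m ] ∑[ z < n ] F x y z a
  ∑-comm³ {l} {m} {n} {o} F = begin
    ∑[ x < l ] ∑[ y < m ] ∑[ z < n ] ∑[ a < o ] F x y z a ≡⟨ sum-cong-≗ (λ x → sum-cong-≗ (λ y → ∑-comm (F x y))) ⟩
    ∑[ x < l ] ∑[ y < m ] ∑[ a < o ] ∑[ z < n ] F x y z a ≡⟨ sum-cong-≗ (λ x → ∑-comm (λ y a → ∑[ z < n ] F x y z a)) ⟩
    ∑[ x < l ] ∑[ a < o ] ∑[ y < m ] ∑[ z < n ] F x y z a ≡⟨ ∑-comm (λ x a → ∑[ y < m ] ∑[ z < n ] F x y z a) ⟩
    ∑[ a < o ] ∑[ x < l ] ∑[ y < m ] ∑[ z < n ] F x y z a ∎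
    where open ≡-Reasoning

  -- Sets of triples and their k-cores

  TripleSet : ℕ → Set
  TripleSet N = Fin N → Fin N → Fin N → Bool

  module _ {N : ℕ} where

    size : TripleSet N → ℕ
    size h = ∑[ p < N ] ∑[ r < N ] ∑[ s < N ] 𝟙 (h p r s)

    _⊆₃_ : TripleSet N → TripleSet N → Set
    h ⊆₃ h′ = ∀ p r s → h p r s ≡ true → h′ p r s ≡ true

    Inhabited : TripleSet N → Set
    Inhabited h = ∃[ p ] ∃[ r ] ∃[ s ] h p r s ≡ true

    cyclic : Orientation N → TripleSet N
    cyclic T u w x = T u w ∧ (T w x ∧ T x u)

    size>0⇒inhabited : ∀ h → 0 < size h → Inhabited h
    size>0⇒inhabited h size>0 =
      let p , >0 = ∑>0⇒∃>0 _ size>0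
          r , >0 = ∑>0⇒∃>0 _ >0
          s , >0 = ∑>0⇒∃>0 _ >0
      in p , r , s , 𝟙>0⇒≡true >0

    colour-class : ∀ {q} → TripleSet N → (Fin N → Fin N → Fin N → Fin q) → Fin q → TripleSet N
    colour-class h c a p r s = h p r s ∧ does (a ≟ c p r s)

    ∃-large-colour-class : ∀ {q} → 0 < q → (h : TripleSet N) (c : Fin N → Fin N → Fin N → Fin q) →
                           ∃[ a ] size h ≤ q * size (colour-class h c a)
    ∃-large-colour-class {q} q>0 h c =
      let a , ∑≤q*class = ∑-pigeonhole q>0 (size ∘′ colour-class h c)
      in a , subst (_≤ q * size (colour-class h c a)) (sym split) ∑≤q*class
      where
      split : size h ≡ ∑[ a < q ] size (colour-class h c a)
      split = trans (sum-cong-≗ λ p → sum-cong-≗ λ r → sum-cong-≗ λ s → sym (one-class p r s))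
                    (∑-comm³ λ p r s a → 𝟙 (colour-class h c a p r s))
        where
        one-class : ∀ p r s → ∑[ a < q ] 𝟙 (h p r s ∧ does (a ≟ c p r s)) ≡ 𝟙 (h p r s)
        one-class p r s with h p r s
        ... | true  = ∑-𝟙-≟ (c p r s)
        ... | false = sum-replicate-zero q

    link : TripleSet N → Fin 3 → Fin N → Fin N → ℕ
    link h zero             u w = ∑[ x < N ] 𝟙 (h x u w)
    link h (suc zero)       u w = ∑[ x < N ] 𝟙 (h u x w)
    link h (suc (suc zero)) u w = ∑[ x < N ] 𝟙 (h u w x)

    face : Fin 3 → Fin N → Fin N → Fin N → Fin N × Fin N
    face zero             p r s = r , s
    face (suc zero)       p r s = p , s
    face (suc (suc zero)) p r s = p , r

    codeg : TripleSet N → Fin 3 → Fin N → Fin N → Fin N → ℕ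
    codeg h i p r s = uncurry (link h i) (face i p r s)

    HasMinCodegree : ℕ → TripleSet N → Set
    HasMinCodegree k h = ∀ p r s → h p r s ≡ true → ∀ i → k ≤ codeg h i p r s

    capped-links : ℕ → TripleSet N → ℕ
    capped-links k h = ∑[ i < 3 ] ∑[ u < N ] ∑[ w < N ] (link h i u w ⊓ k)

    capped-links≤ : ∀ k h → capped-links k h ≤ 3 * (N * (N * k))
    capped-links≤ k h = ∑≤n*c _ λ i → ∑≤n*c _ λ u → ∑≤n*c k λ w → m⊓n≤n (link h i u w) k

    delete : TripleSet N → Fin N → Fin N → Fin N → TripleSet N
    delete h p r s x y z = if does (x ≟ p) ∧ (does (y ≟ r) ∧ does (z ≟ s)) then false else h x y z

    delete-⊆ : ∀ h p r s → delete h p r s ⊆₃ h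
    delete-⊆ h p r s x y z with does (x ≟ p) ∧ (does (y ≟ r) ∧ does (z ≟ s))
    ... | true  = λ ()
    ... | false = λ hxyz → hxyz

    private
      does-refl : ∀ {n} (x : Fin n) → does (x ≟ x) ≡ true
      does-refl x = dec-true (x ≟ x) refl

    link-delete-≤ : ∀ {h p r s} i u w → link (delete h p r s) i u w ≤ link h i u w
    link-delete-≤ {h} {p} {r} {s} zero             u w = ∑-mono-≤ λ x → 𝟙-mono (delete-⊆ h p r s x u w)
    link-delete-≤ {h} {p} {r} {s} (suc zero)       u w = ∑-mono-≤ λ x → 𝟙-mono (delete-⊆ h p r s u x w)
    link-delete-≤ {h} {p} {r} {s} (suc (suc zero)) u w = ∑-mono-≤ λ x → 𝟙-mono (delete-⊆ h p r s u w x)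

    module _ {h : TripleSet N} {p r s : Fin N} (hprs : h p r s ≡ true) where

      deleted : 𝟙 (delete h p r s p r s) + 1 ≡ 𝟙 (h p r s)
      deleted rewrite does-refl p | does-refl r | does-refl s | hprs = refl

      size-delete : size (delete h p r s) + 1 ≡ size h
      size-delete = ∑-update p 1 other-p (∑-update r 1 other-r (∑-update s 1 other-s deleted))
        where
        other-p : ∀ x → x ≢ p →
                  ∑[ y < N ] ∑[ z < N ] 𝟙 (delete h p r s x y z) ≡ ∑[ y < N ] ∑[ z < N ] 𝟙 (h x y z)
        other-p x x≢p rewrite dec-false (x ≟ p) x≢p = refl
        other-r : ∀ y → y ≢ r → ∑[ z < N ] 𝟙 (delete h p r s p y z) ≡ ∑[ z < N ] 𝟙 (h p y z)
        other-r y y≢r rewrite does-refl p | dec-false (y ≟ r) y≢r = refl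
        other-s : ∀ z → z ≢ s → 𝟙 (delete h p r s p r z) ≡ 𝟙 (h p r z)
        other-s z z≢s rewrite does-refl p | does-refl r | dec-false (z ≟ s) z≢s = refl

      codeg-delete : ∀ i → codeg (delete h p r s) i p r s + 1 ≡ codeg h i p r s
      codeg-delete zero = ∑-update p 1 other deleted
        where
        other : ∀ x → x ≢ p → 𝟙 (delete h p r s x r s) ≡ 𝟙 (h x r s)
        other x x≢p rewrite dec-false (x ≟ p) x≢p = refl
      codeg-delete (suc zero) = ∑-update r 1 other deleted
        where
        other : ∀ x → x ≢ r → 𝟙 (delete h p r s p x s) ≡ 𝟙 (h p x s)
        other x x≢r rewrite does-refl p | dec-false (x ≟ r) x≢r = refl
      codeg-delete (suc (suc zero)) = ∑-update s 1 other deleted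
        where
        other : ∀ x → x ≢ s → 𝟙 (delete h p r s p r x) ≡ 𝟙 (h p r x)
        other x x≢s rewrite does-refl p | does-refl r | dec-false (x ≟ s) x≢s = refl

      capped-links-delete : ∀ {k} i → codeg h i p r s < k → capped-links k (delete h p r s) < capped-links k h
      capped-links-delete {k} i small =
        ∑-mono-< (λ j → ∑-mono-≤ λ u → ∑-mono-≤ λ w → capped j u w) i
          (∑-mono-< (λ u → ∑-mono-≤ λ w → capped i u w) (proj₁ (face i p r s))
            (∑-mono-< (capped i (proj₁ (face i p r s))) (proj₂ (face i p r s)) strictly))
        where
        capped : ∀ j u w → link (delete h p r s) j u w ⊓ k ≤ link h j u w ⊓ k
        capped j u w = ⊓-monoˡ-≤ k (link-delete-≤ {h} {p} {r} {s} j u w)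
        c′<c : codeg (delete h p r s) i p r s < codeg h i p r s
        c′<c = subst (codeg (delete h p r s) i p r s <_) (trans (+-comm 1 _) (codeg-delete i)) ≤-refl
        strictly : codeg (delete h p r s) i p r s ⊓ k < codeg h i p r s ⊓ k
        strictly rewrite m≤n⇒m⊓n≡m (<⇒≤ (<-trans c′<c small)) | m≤n⇒m⊓n≡m (<⇒≤ small) = c′<c

    small-codegree? : ∀ k h → Dec (∃[ p ] ∃[ r ] ∃[ s ] ∃[ i ] (h p r s ≡ true × codeg h i p r s < k))
    small-codegree? k h = Finₚ.any? λ p → Finₚ.any? λ r → Finₚ.any? λ s → Finₚ.any? λ i →
      (h p r s Boolₚ.≟ true) ×-dec (codeg h i p r s <? k)

    -- Each deletion lowers size by
    -- one and capped-links k by at least one, so capped-links k h < size h persists and h never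
    -- becomes empty.
    k-core : ∀ k n h → size h ≡ n → capped-links k h < n →
             ∃[ h′ ] (h′ ⊆₃ h × HasMinCodegree k h′ × Inhabited h′)
    k-core k (suc n) h size≡1+n capped<1+n with small-codegree? k h
    ... | no none =
      h , (λ _ _ _ hprs → hprs) , min-codegree , size>0⇒inhabited h (subst (0 <_) (sym size≡1+n) z<s)
      where
      min-codegree : HasMinCodegree k h
      min-codegree p r s hprs i = ≮⇒≥ λ small → none (p , r , s , i , hprs , small)
    ... | yes (p , r , s , i , hprs , small) =
      let h′ , h′⊆ , min-codegree , inhabited = k-core k n (delete h p r s) size′ capped′
      in h′ , (λ x y z → delete-⊆ h p r s x y z ∘′ h′⊆ x y z) , min-codegree , inhabited
      where
      size′ : size (delete h p r s) ≡ n
      size′ = suc-injective (trans (+-comm 1 _) (trans (size-delete hprs) size≡1+n))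
      capped′ : capped-links k (delete h p r s) < n
      capped′ = <-≤-trans (capped-links-delete hprs i small) (≤-pred capped<1+n)

  -- Backward edges of a tournament and cyclic triangles

  module Tournament {N : ℕ} (T : Orientation N) (tournament : IsTournament T) where

    T-separates : ∀ {v x y} → T v x ≡ true → T v y ≡ false → x ≢ y
    T-separates Tvx Tvy refl with trans (sym Tvx) Tvy
    ... | ()

    T⇒≢ : ∀ {u w} → T u w ≡ true → u ≢ w
    T⇒≢ {u} Tuw = ≢-sym (T-separates Tuw (proj₁ tournament u))

    T-flip : ∀ {u w} → u ≢ w → T w u ≡ not (T u w)
    T-flip {u} {w} u≢w = ¬-not (λ Twu≡Tuw → proj₂ tournament u w u≢w (sym Twu≡Tuw))

    T-asym : ∀ {u w} → T u w ≡ true → T w u ≡ false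
    T-asym Tuw = trans (T-flip (T⇒≢ Tuw)) (cong not Tuw)

    T-connex : ∀ {u w} → u ≢ w → T u w ≡ false → T w u ≡ true
    T-connex u≢w Tuw≡false = trans (T-flip u≢w) (cong not Tuw≡false)

    outdeg : Fin N → ℕ
    outdeg u = ∑[ x < N ] 𝟙 (T u x)

    rank : Fin N → ℕ × Fin N
    rank u = outdeg u , u

    _≺_ : Rel (Fin N) 0ℓ
    _≺_ = ×-Lex _≡_ _>_ Fin._<_ on rank

    ≺-isStrictTotalOrder : IsStrictTotalOrder (Pointwise _≡_ _≡_ on rank) _≺_
    ≺-isStrictTotalOrder = On.isStrictTotalOrder rank
      (×-isStrictTotalOrder (Flip.isStrictTotalOrder <-isStrictTotalOrder) Finₚ.<-isStrictTotalOrder)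

    module ≺ = IsStrictTotalOrder ≺-isStrictTotalOrder

    ranking : Orientation N
    ranking u w = does (u ≺.<? w)

    ranking-isTournament : IsTournament ranking
    ranking-isTournament = (λ u → dec-false (u ≺.<? u) (≺.irrefl (refl , refl))) , opposite
      where
      opposite : ∀ u w → u ≢ w → ranking u w ≢ ranking w u
      opposite u w u≢w with u ≺.<? w | w ≺.<? u
      ... | yes u≺w | yes w≺u = λ _ → ≺.asym u≺w w≺u
      ... | yes _   | no  _   = λ ()
      ... | no  _   | yes _   = λ ()
      ... | no  u⊀w | no  w⊀u with ≺.compare u w
      ...   | tri< u≺w _ _         = λ _ → u⊀w u≺w
      ...   | tri≈ _ (_ , u≡w) _   = λ _ → u≢w u≡w
      ...   | tri> _ _ w≺u         = λ _ → w⊀u w≺u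

    ranking-isTransitive : IsTransitive ranking
    ranking-isTransitive u v w ruv rvw =
      dec-true (u ≺.<? w) (≺.trans (does≡true⇒ (u ≺.<? v) ruv) (does≡true⇒ (v ≺.<? w) rvw))

    backward : Fin N → Fin N → Bool
    backward u w = T u w ∧ not (ranking u w)

    backward⇒T : ∀ {u w} → backward u w ≡ true → T u w ≡ true
    backward⇒T = proj₁ ∘ ∧≡true⇒

    backward⇒outdeg≤ : ∀ {u w} → backward u w ≡ true → outdeg u ≤ outdeg w
    backward⇒outdeg≤ {u} {w} buw with u ≺.<? w
    ... | no u⊀w = ≮⇒≥ (u⊀w ∘ inj₁)
    ... | yes _ with () ← trans (sym buw) (∧-zeroʳ (T u w))

    reversals≡∑backward : reversals T ranking ≡ ∑[ u < N ] ∑[ w < N ] 𝟙 (backward u w)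
    reversals≡∑backward = begin
      reversals T ranking                                           ≡⟨ sum-map-allFin N _ ⟩
      ∑[ u < N ] List.sum (List.map (reversed u) (List.allFin N))  ≡⟨ sum-cong-≗ (λ u → sum-map-allFin N (reversed u)) ⟩
      ∑[ u < N ] ∑[ w < N ] reversed u w                            ≡⟨ sum-cong-≗ (λ u → sum-cong-≗ (reversed≡𝟙backward u)) ⟩
      ∑[ u < N ] ∑[ w < N ] 𝟙 (backward u w)                        ∎
      where
      open ≡-Reasoning
      reversed : Fin N → Fin N → ℕ
      reversed u w = if T u w then (if ranking u w then 0 else 1) else 0
      reversed≡𝟙backward : ∀ u w → reversed u w ≡ 𝟙 (backward u w)
      reversed≡𝟙backward u w with T u w | ranking u w
      ... | true  | true  = refl
      ... | true  | false = refl
      ... | false | _     = refl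

    closing : Fin N → Fin N → ℕ
    closing u w = ∑[ x < N ] 𝟙 (T w x ∧ T x u)

    closing-pointwise : ∀ {u w} → T u w ≡ true → ∀ x →
      𝟙 (T w x) + 𝟙 (backward u x ∧ T x w) + 𝟙 (does (x ≟ w)) ≤ 𝟙 (T w x ∧ T x u) + 𝟙 (T u x)
    closing-pointwise {u} {w} Tuw x with x ≟ w
    ... | yes refl rewrite proj₁ tournament x | ∧-zeroʳ (backward u x) | Tuw = ≤-refl
    ... | no x≢w with T w x in Twx
    ...   | false = subst (_≤ 𝟙 (T u x)) (sym (+-identityʳ _)) (𝟙-mono (backward⇒T ∘ proj₁ ∘ ∧≡true⇒))
    ...   | true rewrite T-asym Twx | ∧-zeroʳ (backward u x) with T x u in Txu
    ...     | true  = s≤s z≤n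
    ...     | false rewrite T-connex (T-separates Twx (T-asym Tuw)) Txu = ≤-refl

    -- Out(u) contains w, the backward out-neighbours x → w of u, and every out-neighbour x of w
    -- with u → x; as outdeg u ≤ outdeg w, the remaining out-neighbours of w (those with x → u)
    -- number at least 1 + #{x : backward u x, x → w}.
    backward-closing : ∀ {u w} → backward u w ≡ true →
                       ∑[ x < N ] 𝟙 (backward u x ∧ T x w) + 1 ≤ closing u w
    backward-closing {u} {w} buw = +-cancelˡ-≤ (outdeg w) _ _ (begin
      outdeg w + (I + 1)                                 ≡⟨ +-assoc (outdeg w) I 1 ⟨
      outdeg w + I + 1                                   ≡⟨ cong (outdeg w + I +_) (∑-𝟙-≟ w) ⟨
      outdeg w + I + ∑[ x < N ] 𝟙 (does (x ≟ w))         ≡⟨ ∑-distrib-+³ (𝟙 ∘ T w) into-w (λ x → 𝟙 (does (x ≟ w))) ⟨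
      ∑[ x < N ] (𝟙 (T w x) + into-w x + 𝟙 (does (x ≟ w)))
                                                         ≤⟨ ∑-mono-≤ (closing-pointwise (backward⇒T buw)) ⟩
      ∑[ x < N ] (𝟙 (T w x ∧ T x u) + 𝟙 (T u x))         ≡⟨ ∑-distrib-+ (λ x → 𝟙 (T w x ∧ T x u)) (𝟙 ∘ T u) ⟩
      closing u w + outdeg u                             ≤⟨ +-monoʳ-≤ (closing u w) (backward⇒outdeg≤ buw) ⟩
      closing u w + outdeg w                             ≡⟨ +-comm (closing u w) (outdeg w) ⟩
      outdeg w + closing u w                             ∎)
      where
      open ≤-Reasoning
      into-w : Fin N → ℕ
      into-w x = 𝟙 (backward u x ∧ T x w)
      I = sum into-w

    backdeg : Fin N → ℕ
    backdeg u = ∑[ w < N ] 𝟙 (backward u w)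

    backward-pairs : Fin N → ℕ
    backward-pairs u = ∑[ w < N ] ∑[ x < N ] 𝟙 (backward u w ∧ (backward u x ∧ T x w))

    triangles-at : Fin N → ℕ
    triangles-at u = ∑[ w < N ] ∑[ x < N ] 𝟙 (cyclic T u w x)

    backdeg²≤ : ∀ u → backdeg u * backdeg u ≤ 2 * backward-pairs u + backdeg u
    backdeg²≤ u = begin
      b * b                                                ≡⟨ *-distribʳ-sum b (λ w → 𝟙 (β w)) ⟩
      ∑[ w < N ] (𝟙 (β w) * b)                             ≡⟨ sum-cong-≗ (λ w → *-distribˡ-sum (𝟙 (β w)) (λ x → 𝟙 (β x))) ⟩
      ∑[ w < N ] ∑[ x < N ] (𝟙 (β w) * 𝟙 (β x))           ≤⟨ ∑-mono-≤ (λ w → ∑-mono-≤ (split w)) ⟩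
      ∑[ w < N ] ∑[ x < N ] (into w x + outof w x + diag w x)
                                                           ≡⟨ sum-cong-≗ (λ w → ∑-distrib-+³ (into w) (outof w) (diag w)) ⟩
      ∑[ w < N ] (sum (into w) + sum (outof w) + sum (diag w))
                                                           ≡⟨ ∑-distrib-+³ (sum ∘ into) (sum ∘ outof) (sum ∘ diag) ⟩
      P + ∑[ w < N ] sum (outof w) + ∑[ w < N ] sum (diag w)
                                                           ≡⟨ cong₂ (λ P′ b′ → P + P′ + b′) outof≡into (sum-cong-≗ diagonal) ⟩
      P + P + b                                            ≡⟨ cong (λ P′ → P + P′ + b) (+-identityʳ P) ⟨
      2 * P + b                                            ∎
      where
      open ≤-Reasoning
      β = backward u
      b = backdeg u
      P = backward-pairs u
      into outof diag : Fin N → Fin N → ℕ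
      into  w x = 𝟙 (β w ∧ (β x ∧ T x w))
      outof w x = 𝟙 (β w ∧ (β x ∧ T w x))
      diag  w x = 𝟙 (β w ∧ does (x ≟ w))
      split : ∀ w x → 𝟙 (β w) * 𝟙 (β x) ≤ into w x + outof w x + diag w x
      split w x with β w | β x | x ≟ w
      ... | false | _     | _       = z≤n
      ... | true  | false | _       = z≤n
      ... | true  | true  | yes _   = m≤n+m 1 _
      ... | true  | true  | no x≢w with T x w in Txw
      ...   | true  = s≤s z≤n
      ...   | false rewrite T-connex x≢w Txw = s≤s z≤n
      diagonal : ∀ w → sum (diag w) ≡ 𝟙 (β w)
      diagonal w with β w
      ... | true  = ∑-𝟙-≟ w
      ... | false = sum-replicate-zero N
      outof≡into : ∑[ w < N ] sum (outof w) ≡ P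
      outof≡into = trans (∑-comm outof) (sum-cong-≗ λ x → sum-cong-≗ λ w → cong 𝟙 (x∙yz≈y∙xz (β w) (β x) (T w x)))

    backward-pairs+backdeg≤ : ∀ u → backward-pairs u + backdeg u ≤ triangles-at u
    backward-pairs+backdeg≤ u = begin
      backward-pairs u + backdeg u
        ≡⟨ ∑-distrib-+ (λ w → ∑[ x < N ] 𝟙 (backward u w ∧ (backward u x ∧ T x w))) (𝟙 ∘ backward u) ⟨
      ∑[ w < N ] (∑[ x < N ] 𝟙 (backward u w ∧ (backward u x ∧ T x w)) + 𝟙 (backward u w))
        ≤⟨ ∑-mono-≤ at ⟩
      triangles-at u
        ∎
      where
      open ≤-Reasoning
      at : ∀ w → ∑[ x < N ] 𝟙 (backward u w ∧ (backward u x ∧ T x w)) + 𝟙 (backward u w)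
               ≤ ∑[ x < N ] 𝟙 (cyclic T u w x)
      at w with backward u w in buw
      ... | false = ≤-trans (≤-reflexive (trans (+-identityʳ _) (sum-replicate-zero N))) z≤n
      ... | true  = ≤-trans (backward-closing buw) (≤-reflexive (sum-cong-≗ λ x →
                      cong (λ t → 𝟙 (t ∧ (T w x ∧ T x u))) (sym (backward⇒T buw))))

    reversals²≤ : reversals T ranking * reversals T ranking ≤ N * (2 * size (cyclic T))
    reversals²≤ = begin
      reversals T ranking * reversals T ranking  ≡⟨ cong (λ B → B * B) reversals≡∑backward ⟩
      ∑[ u < N ] backdeg u * ∑[ u < N ] backdeg u ≤⟨ cauchy-schwarz backdeg ⟩
      N * ∑[ u < N ] (backdeg u * backdeg u)      ≤⟨ *-monoʳ-≤ N (∑-mono-≤ backdeg²≤2triangles) ⟩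
      N * ∑[ u < N ] (2 * triangles-at u)         ≡⟨ cong (N *_) (*-distribˡ-sum 2 triangles-at) ⟨
      N * (2 * size (cyclic T))                   ∎
      where
      open ≤-Reasoning
      backdeg²≤2triangles : ∀ u → backdeg u * backdeg u ≤ 2 * triangles-at u
      backdeg²≤2triangles u = begin
        backdeg u * backdeg u                      ≤⟨ backdeg²≤ u ⟩
        2 * backward-pairs u + backdeg u           ≤⟨ +-monoʳ-≤ (2 * backward-pairs u) (m≤n*m (backdeg u) 2) ⟩
        2 * backward-pairs u + 2 * backdeg u       ≡⟨ *-distribˡ-+ 2 (backward-pairs u) (backdeg u) ⟨
        2 * (backward-pairs u + backdeg u)         ≤⟨ *-monoʳ-≤ 2 (backward-pairs+backdeg≤ u) ⟩
        2 * triangles-at u                         ∎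

  -- Periodic paths

  _◃_ : ∀ {A : Set} → A → (ℕ → A) → ℕ → A
  (w ◃ v) zero    = w
  (w ◃ v) (suc i) = v i

  distinct-◃ : ∀ {N L w} {v : ℕ → Fin N} → Distinct L v → (∀ i → i < L → v i ≢ w) → Distinct (suc L) (w ◃ v)
  distinct-◃ dv fresh zero    zero    _         _         _     = refl
  distinct-◃ dv fresh zero    (suc j) _         (s≤s j<L) w≡vj  = ⊥-elim (fresh j j<L (sym w≡vj))
  distinct-◃ dv fresh (suc i) zero    (s≤s i<L) _         vi≡w  = ⊥-elim (fresh i i<L vi≡w)
  distinct-◃ dv fresh (suc i) (suc j) (s≤s i<L) (s≤s j<L) vi≡vj = cong suc (dv i j i<L j<L vi≡vj)

  ∃-fresh : ∀ {N} (v : ℕ → Fin N) L (P : Fin N → Bool) → L < ∑[ w < N ] 𝟙 (P w) →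
            ∃[ w ] (P w ≡ true × ∀ i → i < L → v i ≢ w)
  ∃-fresh v zero P 0<∑ = let w , 0<𝟙 = ∑>0⇒∃>0 _ 0<∑ in w , 𝟙>0⇒≡true 0<𝟙 , λ _ ()
  ∃-fresh {N} v (suc L) P 1+L<∑ =
    let w , P′w , fresh = ∃-fresh v L P′ L<∑′
        Pw , w≢vL = ∧≡true⇒ P′w
    in w , Pw , fresh′ w fresh (not-does≡true⇒¬ (w ≟ v L) w≢vL ∘ sym)
    where
    fresh′ : ∀ w → (∀ i → i < L → v i ≢ w) → v L ≢ w → ∀ i → i < suc L → v i ≢ w
    fresh′ w fresh vL≢w i i<1+L with m≤n⇒m<n∨m≡n (≤-pred i<1+L)
    ... | inj₁ i<L  = fresh i i<L
    ... | inj₂ refl = vL≢w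
    P′ : Fin N → Bool
    P′ w = P w ∧ not (does (w ≟ v L))
    split : ∀ w → 𝟙 (P w) ≤ 𝟙 (P′ w) + 𝟙 (does (w ≟ v L))
    split w with P w | does (w ≟ v L)
    ... | true  | true  = s≤s z≤n
    ... | true  | false = s≤s z≤n
    ... | false | _     = z≤n
    L<∑′ : L < ∑[ w < N ] 𝟙 (P′ w)
    L<∑′ = +-cancelʳ-< 1 L _ (begin-strict
      L + 1                                                    ≡⟨ +-comm L 1 ⟩
      suc L                                                    <⟨ 1+L<∑ ⟩
      ∑[ w < N ] 𝟙 (P w)                                        ≤⟨ ∑-mono-≤ split ⟩
      ∑[ w < N ] (𝟙 (P′ w) + 𝟙 (does (w ≟ v L)))               ≡⟨ ∑-distrib-+ (λ w → 𝟙 (P′ w)) _ ⟩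
      ∑[ w < N ] 𝟙 (P′ w) + ∑[ w < N ] 𝟙 (does (w ≟ v L))      ≡⟨ cong (∑[ w < N ] 𝟙 (P′ w) +_) (∑-𝟙-≟ (v L)) ⟩
      ∑[ w < N ] 𝟙 (P′ w) + 1                                  ∎)
      where open ≤-Reasoning

  next prev : Fin 3 → Fin 3
  next zero             = suc zero
  next (suc zero)       = suc (suc zero)
  next (suc (suc zero)) = zero
  prev zero             = suc (suc zero)
  prev (suc zero)       = zero
  prev (suc (suc zero)) = suc zero

  next-prev : ∀ t → next (prev t) ≡ t
  next-prev zero             = refl
  next-prev (suc zero)       = refl
  next-prev (suc (suc zero)) = refl

  next³ : ∀ t → next (next (next t)) ≡ t
  next³ zero             = refl
  next³ (suc zero)       = refl
  next³ (suc (suc zero)) = refl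

  rotate : Fin 3 → ℕ → Fin 3
  rotate t zero    = t
  rotate t (suc i) = rotate (next t) i

  rotate-+*3 : ∀ t r n → rotate t (r + n * 3) ≡ rotate t r
  rotate-+*3 t (suc r) n       = rotate-+*3 (next t) r n
  rotate-+*3 t zero    zero    = refl
  rotate-+*3 t zero    (suc n) = trans (cong (λ t′ → rotate t′ (n * 3)) (next³ t)) (rotate-+*3 t zero n)

  rotate-periodic : ∀ t {i j} → i % 3 ≡ j % 3 → rotate t i ≡ rotate t j
  rotate-periodic t {i} {j} i≡j = begin
    rotate t i                         ≡⟨ cong (rotate t) (m≡m%n+[m/n]*n i 3) ⟩
    rotate t (i % 3 + (i / 3) * 3)     ≡⟨ rotate-+*3 t (i % 3) (i / 3) ⟩
    rotate t (i % 3)                   ≡⟨ cong (rotate t) i≡j ⟩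
    rotate t (j % 3)                   ≡⟨ rotate-+*3 t (j % 3) (j / 3) ⟨
    rotate t (j % 3 + (j / 3) * 3)     ≡⟨ cong (rotate t) (m≡m%n+[m/n]*n j 3) ⟨
    rotate t j                         ∎
    where open ≡-Reasoning

  module Coloured {N q : ℕ} (T : Orientation N) (tournament : IsTournament T)
                  (col : Colouring N q) (col-sym : IsEdgeColouring col) where

    open Tournament T tournament using (T⇒≢; ranking; reversals²≤)

    record PeriodicPath (L : ℕ) : Set where
      field
        vertex            : ℕ → Fin N
        distinct          : Distinct L vertex
        forward           : ∀ i → suc i < L → T (vertex i) (vertex (suc i)) ≡ true
        backward          : ∀ i → suc (suc i) < L → T (vertex (suc (suc i))) (vertex i) ≡ true
        phase             : ℕ → Fin 3
        phase-periodic    : ∀ {i j} → i % 3 ≡ j % 3 → phase i ≡ phase j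
        forward-colour    : Fin 3 → Fin q
        backward-colour   : Fin 3 → Fin q
        forward-coloured  : ∀ i → suc i < L → col (vertex i) (vertex (suc i)) ≡ forward-colour (phase i)
        backward-coloured : ∀ i → suc (suc i) < L →
                            col (vertex i) (vertex (suc (suc i))) ≡ backward-colour (phase i)

      directed : IsDirectedPath T L vertex
      directed = distinct , forward

      three-colours : AtMostThreeColours col L vertex
      three-colours = forward-colour , λ i i+1<L → phase i , forward-coloured i i+1<L

      forward-periodic : ∀ i j → suc i < L → suc j < L → i % 3 ≡ j % 3 →
                         col (vertex i) (vertex (suc i)) ≡ col (vertex j) (vertex (suc j))
      forward-periodic i j i+1<L j+1<L i≡j =
        trans (forward-coloured i i+1<L)
              (trans (cong forward-colour (phase-periodic i≡j)) (sym (forward-coloured j j+1<L)))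

      backward-periodic : ∀ i j → suc (suc i) < L → suc (suc j) < L → i % 3 ≡ j % 3 →
                          col (vertex i) (vertex (suc (suc i))) ≡ col (vertex j) (vertex (suc (suc j)))
      backward-periodic i j i+2<L j+2<L i≡j =
        trans (backward-coloured i i+2<L)
              (trans (cong backward-colour (phase-periodic i≡j)) (sym (backward-coloured j j+2<L)))

    record Triangle (a : Fin 3 → Fin q) (t : Fin 3) (x y z : Fin N) : Set where
      field
        xy     : T x y ≡ true
        yz     : T y z ≡ true
        zx     : T z x ≡ true
        col-xy : col x y ≡ a t
        col-yz : col y z ≡ a (next t)
        col-zx : col z x ≡ a (next (next t))

    triangle-rotate : ∀ {a t x y z} → Triangle a t x y z → Triangle a (next t) y z x
    triangle-rotate {a} {t} tr = record
      { xy = yz ; yz = zx ; zx = xy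
      ; col-xy = col-yz ; col-yz = col-zx ; col-zx = trans col-xy (cong a (sym (next³ t)))
      }
      where open Triangle tr

    pattern-class : (Fin 3 → Fin q) → TripleSet N
    pattern-class a =
      colour-class (colour-class (colour-class (cyclic T) (λ p r _ → col p r) (a zero))
                                 (λ _ r s → col r s) (a (suc zero)))
                   (λ p _ s → col s p) (a (suc (suc zero)))

    pattern-class⇒triangle : ∀ a {p r s} → pattern-class a p r s ≡ true → Triangle a zero p r s
    pattern-class⇒triangle a {p} {r} {s} e =
      let e′ , c₂ = ∧≡true⇒ e
          e″ , c₁ = ∧≡true⇒ e′
          e‴ , c₀ = ∧≡true⇒ e″
          Tpr , e⁗ = ∧≡true⇒ e‴
          Trs , Tsp = ∧≡true⇒ e⁗
      in record
        { xy = Tpr ; yz = Trs ; zx = Tsp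
        ; col-xy = sym (does≡true⇒ (_ ≟ _) c₀)
        ; col-yz = sym (does≡true⇒ (_ ≟ _) c₁)
        ; col-zx = sym (does≡true⇒ (_ ≟ _) c₂)
        }

    ∃-large-pattern-class : 0 < q → ∃[ a ] size (cyclic T) ≤ q * (q * (q * size (pattern-class a)))
    ∃-large-pattern-class q>0 =
      let a₀ , ≤₀ = ∃-large-colour-class q>0 (cyclic T) (λ p r _ → col p r)
          a₁ , ≤₁ = ∃-large-colour-class q>0 _ (λ _ r s → col r s)
          a₂ , ≤₂ = ∃-large-colour-class q>0 _ (λ p _ s → col s p)
      in a₀ ∷ a₁ ∷ a₂ ∷ [] , ≤-trans ≤₀ (*-monoʳ-≤ q (≤-trans ≤₁ (*-monoʳ-≤ q ≤₂)))

    module Paths (a : Fin 3 → Fin q) (k : ℕ) (h : TripleSet N)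
                 (h⊆ : h ⊆₃ pattern-class a) (h-min : HasMinCodegree k h) where

      window : Fin 3 → TripleSet N
      window zero             x y z = h x y z
      window (suc zero)       x y z = h z x y
      window (suc (suc zero)) x y z = h y z x

      h-triangle : ∀ {p r s} → h p r s ≡ true → Triangle a zero p r s
      h-triangle e = pattern-class⇒triangle a (h⊆ _ _ _ e)

      window-triangle : ∀ t {x y z} → window t x y z ≡ true → Triangle a t x y z
      window-triangle zero             e = h-triangle e
      window-triangle (suc zero)       e = triangle-rotate (h-triangle e)
      window-triangle (suc (suc zero)) e = triangle-rotate (triangle-rotate (h-triangle e))

      window-extensions : ∀ t {x y z} → window t x y z ≡ true → k ≤ ∑[ w < N ] 𝟙 (window (prev t) w x y)
      window-extensions zero             {x} {y} {z} e = h-min x y z e (suc (suc zero))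
      window-extensions (suc zero)       {x} {y} {z} e = h-min z x y e zero
      window-extensions (suc (suc zero)) {x} {y} {z} e = h-min y z x e (suc zero)

      record Path (t : Fin 3) (L : ℕ) : Set where
        field
          vertex            : ℕ → Fin N
          distinct          : Distinct L vertex
          forward           : ∀ i → suc i < L → T (vertex i) (vertex (suc i)) ≡ true
          backward          : ∀ i → suc (suc i) < L → T (vertex (suc (suc i))) (vertex i) ≡ true
          forward-coloured  : ∀ i → suc i < L → col (vertex i) (vertex (suc i)) ≡ a (rotate t i)
          backward-coloured : ∀ i → suc (suc i) < L →
                              col (vertex i) (vertex (suc (suc i))) ≡ a (next (next (rotate t i)))
          head              : window t (vertex 0) (vertex 1) (vertex 2) ≡ true

      initial : ∀ {p r s} → h p r s ≡ true → Path zero 3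
      initial {p} {r} {s} hprs = record
        { vertex            = p ◃ (r ◃ (s ◃ λ _ → s))
        ; distinct          = distinct-◃ (distinct-◃ (distinct-◃ (λ _ _ ()) λ _ ()) fresh-r) fresh-p
        ; forward           = λ { zero _ → xy ; (suc zero) _ → yz ; (suc (suc _)) (s≤s (s≤s (s≤s ()))) }
        ; backward          = λ { zero _ → zx ; (suc _) (s≤s (s≤s (s≤s ()))) }
        ; forward-coloured  = λ { zero _ → col-xy ; (suc zero) _ → col-yz ; (suc (suc _)) (s≤s (s≤s (s≤s ()))) }
        ; backward-coloured = λ { zero _ → trans (col-sym p s) col-zx ; (suc _) (s≤s (s≤s (s≤s ()))) }
        ; head              = hprs
        }
        where
        open Triangle (h-triangle hprs)
        fresh-r : ∀ i → i < 1 → (s ◃ λ _ → s) i ≢ r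
        fresh-r zero    _        = T⇒≢ yz ∘ sym
        fresh-r (suc _) (s≤s ())
        fresh-p : ∀ i → i < 2 → (r ◃ (s ◃ λ _ → s)) i ≢ p
        fresh-p zero          _              = T⇒≢ xy ∘ sym
        fresh-p (suc zero)    _              = T⇒≢ zx
        fresh-p (suc (suc _)) (s≤s (s≤s ()))

      -- Paths grow at the front: index i + 1 of w ◃ v is index i of v, so only the phase moves.
      extend : ∀ {t L} → L < k → Path t L → Path (prev t) (suc L)
      extend {t} {L} L<k P = record
        { vertex            = w ◃ vertex
        ; distinct          = distinct-◃ distinct w-fresh
        ; forward           = λ { zero _ → xy ; (suc i) i+2≤L+1 → forward i (≤-pred i+2≤L+1) }
        ; backward          = λ { zero _ → zx ; (suc i) i+3≤L+1 → backward i (≤-pred i+3≤L+1) }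
        ; forward-coloured  = λ { zero _ → col-xy
                                ; (suc i) i+2≤L+1 → subst (λ t′ → _ ≡ a (rotate t′ i)) (sym (next-prev t))
                                                          (forward-coloured i (≤-pred i+2≤L+1)) }
        ; backward-coloured = λ { zero _ → trans (col-sym w (vertex 1)) col-zx
                                ; (suc i) i+3≤L+1 → subst (λ t′ → _ ≡ a (next (next (rotate t′ i)))) (sym (next-prev t))
                                                          (backward-coloured i (≤-pred i+3≤L+1)) }
        ; head              = w-window
        }
        where
        open Path P
        candidates = ∃-fresh vertex L (λ w → window (prev t) w (vertex 0) (vertex 1))
                             (<-≤-trans L<k (window-extensions t head))
        w        = proj₁ candidates
        w-window = proj₁ (proj₂ candidates)
        w-fresh  = proj₂ (proj₂ candidates)
        open Triangle (window-triangle (prev t) w-window)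

      path : ∀ n → n ≤ k ∸ 3 → Inhabited h → ∃[ t ] Path t (3 + n)
      path zero    _       (p , r , s , hprs) = zero , initial hprs
      path (suc n) 1+n≤k∸3 inhabited =
        let t , P = path n (≤-trans (n≤1+n n) 1+n≤k∸3) inhabited
        in prev t , extend (m<n∸o⇒o+m<n k 3 1+n≤k∸3) P

      periodic : ∀ {t L} → Path t L → PeriodicPath L
      periodic {t} P = record
        { vertex = vertex ; distinct = distinct ; forward = forward ; backward = backward
        ; phase = rotate t ; phase-periodic = λ {i} {j} → rotate-periodic t {i} {j}
        ; forward-colour = a ; backward-colour = a ∘ next ∘ next
        ; forward-coloured = forward-coloured ; backward-coloured = backward-coloured
        }
        where open Path P

    class⇒periodic-path : ∀ a → 0 < N → 0 < size (pattern-class a) →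
                           ∃[ L ] (PeriodicPath L × size (pattern-class a) ≤ 3 * (N * N) * (2 * L))
    class⇒periodic-path a N>0 S>0 =
      let h , h⊆ , h-min , inhabited = k-core k S (pattern-class a) refl capped<S
          t , P = Paths.path a k h h⊆ h-min (k ∸ 3) ≤-refl inhabited
      in L , Paths.periodic a k h h⊆ h-min P , S≤d*2L
      where
      S = size (pattern-class a)
      d = 3 * (N * N)
      instance
        d≢0 : NonZero d
        d≢0 = >-nonZero (≤-trans (s≤s z≤n) (*-monoʳ-≤ 3 (*-mono-≤ N>0 N>0)))
      k = (S ∸ 1) / d
      L = 3 + (k ∸ 3)
      capped<S : capped-links k (pattern-class a) < S
      capped<S = ≤-<-trans (capped-links≤ k (pattern-class a))
                   (subst (_< S) (trans (*-assoc 3 (N * N) k) (cong (3 *_) (*-assoc N N k)))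
                          (proj₁ (division-threshold d S S>0)))
      1≤L : 1 ≤ L
      1≤L = s≤s z≤n
      1+k≤2L : suc k ≤ 2 * L
      1+k≤2L = subst (suc k ≤_) (cong (L +_) (sym (+-identityʳ L))) (+-mono-≤ 1≤L (m≤n+m∸n k 3))
      S≤d*2L : S ≤ d * (2 * L)
      S≤d*2L = ≤-trans (proj₂ (division-threshold d S S>0)) (*-monoʳ-≤ d 1+k≤2L)

    reversals⇒periodic-path : 0 < q → 0 < reversals T ranking →
      ∃[ L ] (PeriodicPath L × reversals T ranking * reversals T ranking ≤ 12 * (N * N * N * (L * q ^ 3)))
    reversals⇒periodic-path q>0 B>0 =
      let a , triangles≤ = ∃-large-pattern-class q>0
          B²≤ = ≤-trans reversals²≤ (*-monoʳ-≤ N (*-monoʳ-≤ 2 triangles≤))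
          N>0 , rest>0 = *-pos N _ (<-≤-trans (*-mono-≤ B>0 B>0) B²≤)
          S>0 = proj₂ (*-pos q _ (proj₂ (*-pos q _ (proj₂ (*-pos q _ (proj₂ (*-pos 2 _ rest>0)))))))
          L , P , S≤ = class⇒periodic-path a N>0 S>0
      in L , P , ≤-trans B²≤ (≤-trans (*-monoʳ-≤ N (*-monoʳ-≤ 2 (*-monoʳ-≤ q (*-monoʳ-≤ q (*-monoʳ-≤ q S≤)))))
                                      (≤-reflexive (rearrange N q L)))
      where
      rearrange : ∀ N q L → N * (2 * (q * (q * (q * (3 * (N * N) * (2 * L))))))
                          ≡ 12 * (N * N * N * (L * (q * (q * (q * 1)))))
      rearrange = solve-∀

open import Data.Nat as ℕ using (ℕ; zero; suc; _%_; _^_; z<s)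
open import Data.Rational as ℚ using (ℚ; _*_; _≤_; _<_; 0ℚ; 1ℚ; mkℚ; *≤*; NonNegative; Positive)
open import Data.Fin using (Fin)
open import Data.Bool using (true)
open import Data.Product using (Σ; _×_; ∃; ∃-syntax; _,_)
open import Relation.Binary.PropositionalEquality
  using (_≡_; refl; sym; trans; cong; cong₂; subst₂; module ≡-Reasoning)
open import Data.Empty using (⊥-elim)
open import Data.Integer as ℤ using (+_)
import Data.Integer.Properties as ℤₚ
import Data.Nat.Coprimality as Coprime
open import Data.Rational.Properties
  using (↥p/↧p≡p; normalize-nonNeg; normalize-pos; nonNegative⁻¹; positive⁻¹; ≰⇒>; <⇒≤; pos⇒nonNeg;
         *-zeroʳ; *-assoc; *-identityˡ; *-monoʳ-≤-nonNeg; *-monoˡ-≤-nonNeg; *-cancelʳ-≤-pos;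
         nonNeg*nonNeg⇒nonNeg; module ≤-Reasoning)
open import Data.Rational.Solver using (module +-*-Solver)
open import Relation.Nullary using (¬_)
open Combinatorial using (module Tournament; module Coloured)

-- Arithmetic in ℚ

-- `⟦ n ⟧ = + n / 1` only normalises for closed n; ℕ→ℚ n is its normal form, on which _*_ computes.
ℕ→ℚ : ℕ → ℚ
ℕ→ℚ n = mkℚ (+ n) 0 (Coprime.sym (Coprime.1-coprimeTo n))

⟦⟧≡ℕ→ℚ : ∀ n → ⟦ n ⟧ ≡ ℕ→ℚ n
⟦⟧≡ℕ→ℚ n = ↥p/↧p≡p (ℕ→ℚ n)

⟦⟧-* : ∀ m n → ⟦ m ℕ.* n ⟧ ≡ ⟦ m ⟧ * ⟦ n ⟧
⟦⟧-* m n = begin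
  ⟦ m ℕ.* n ⟧          ≡⟨ cong (ℚ._/ 1) (ℤₚ.pos-* m n) ⟩
  (+ m ℤ.* + n) ℚ./ 1  ≡⟨⟩
  ℕ→ℚ m * ℕ→ℚ n        ≡⟨ cong₂ _*_ (⟦⟧≡ℕ→ℚ m) (⟦⟧≡ℕ→ℚ n) ⟨
  ⟦ m ⟧ * ⟦ n ⟧        ∎
  where open ≡-Reasoning

⟦⟧-mono-≤ : ∀ {m n} → m ℕ.≤ n → ⟦ m ⟧ ≤ ⟦ n ⟧
⟦⟧-mono-≤ {m} {n} m≤n rewrite ⟦⟧≡ℕ→ℚ m | ⟦⟧≡ℕ→ℚ n =
  *≤* (subst₂ ℤ._≤_ (sym (ℤₚ.*-identityʳ (+ m))) (sym (ℤₚ.*-identityʳ (+ n))) (ℤ.+≤+ m≤n))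

far⇒n>0 : ∀ {δ m n} → 0ℚ < δ → ¬ (⟦ n ⟧ ≤ δ * ⟦ m ⟧) → 0 ℕ.< n
far⇒n>0 {n = suc _} _ _ = z<s
far⇒n>0 {δ} {m} {zero} δ>0 far = ⊥-elim (far (nonNegative⁻¹ (δ * ⟦ m ⟧)))
  where
  instance
    δ≥0 : NonNegative δ
    δ≥0 = pos⇒nonNeg δ {{ℚ.positive δ>0}}
    m≥0 : NonNegative ⟦ m ⟧
    m≥0 = normalize-nonNeg m 1
    δm≥0 : NonNegative (δ * ⟦ m ⟧)
    δm≥0 = nonNeg*nonNeg⇒nonNeg δ ⟦ m ⟧

far⇒δ²N≤12X : ∀ {δ N B X} → 0 ℕ.< N → 0ℚ < δ → ¬ (⟦ B ⟧ ≤ δ * ⟦ N ℕ.* N ⟧) →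
              B ℕ.* B ℕ.≤ 12 ℕ.* (N ℕ.* N ℕ.* N ℕ.* X) → δ * δ * ⟦ N ⟧ ≤ ⟦ 12 ⟧ * ⟦ X ⟧
far⇒δ²N≤12X {δ} {N@(suc _)} {B} {X} _ δ>0 far B²≤ = *-cancelʳ-≤-pos n³ (begin
  δ * δ * n * n³               ≡⟨ y²≡ ⟨
  y * y                        ≤⟨ *-monoʳ-≤-nonNeg y y≤B ⟩
  ⟦ B ⟧ * y                    ≤⟨ *-monoˡ-≤-nonNeg ⟦ B ⟧ y≤B ⟩
  ⟦ B ⟧ * ⟦ B ⟧                ≡⟨ ⟦⟧-* B B ⟨
  ⟦ B ℕ.* B ⟧                  ≤⟨ ⟦⟧-mono-≤ B²≤ ⟩
  ⟦ 12 ℕ.* (N³ ℕ.* X) ⟧        ≡⟨ trans (⟦⟧-* 12 (N³ ℕ.* X)) (cong (⟦ 12 ⟧ *_) (⟦⟧-* N³ X)) ⟩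
  ⟦ 12 ⟧ * (n³ * ⟦ X ⟧)        ≡⟨ solve 3 (λ c m x → c :* (m :* x) := c :* x :* m) refl ⟦ 12 ⟧ n³ ⟦ X ⟧ ⟩
  ⟦ 12 ⟧ * ⟦ X ⟧ * n³          ∎)
  where
  open ≤-Reasoning
  open +-*-Solver using (solve; _:*_; _:=_)
  N³ = N ℕ.* N ℕ.* N
  n  = ⟦ N ⟧
  n³ = ⟦ N³ ⟧
  y  = δ * ⟦ N ℕ.* N ⟧
  instance
    δ≥0 : NonNegative δ
    δ≥0 = pos⇒nonNeg δ {{ℚ.positive δ>0}}
    N²≥0 : NonNegative ⟦ N ℕ.* N ⟧
    N²≥0 = normalize-nonNeg (N ℕ.* N) 1
    B≥0 : NonNegative ⟦ B ⟧
    B≥0 = normalize-nonNeg B 1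
    y≥0 : NonNegative y
    y≥0 = nonNeg*nonNeg⇒nonNeg δ ⟦ N ℕ.* N ⟧
    n³>0 : Positive n³
    n³>0 = normalize-pos N³ 1
  y≤B : y ≤ ⟦ B ⟧
  y≤B = <⇒≤ (≰⇒> far)
  y²≡ : y * y ≡ δ * δ * n * n³
  y²≡ = begin-equality
    y * y                          ≡⟨ cong (λ m → δ * m * (δ * m)) (⟦⟧-* N N) ⟩
    δ * (n * n) * (δ * (n * n))    ≡⟨ solve 2 (λ d n → d :* (n :* n) :* (d :* (n :* n)) := d :* d :* n :* (n :* n :* n))
                                              refl δ n ⟩
    δ * δ * n * (n * n * n)        ≡⟨ cong (δ * δ * n *_) (trans (⟦⟧-* (N ℕ.* N) N) (cong (_* n) (⟦⟧-* N N))) ⟨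
    δ * δ * n * n³                 ∎

c₀ : ℚ
c₀ = + 1 ℚ./ 12

c₀>0 : 0ℚ < c₀
c₀>0 = positive⁻¹ c₀ {{normalize-pos 1 12}}

far⇒bound : ∀ {δ N B X} → 0ℚ < δ → ¬ (⟦ B ⟧ ≤ δ * ⟦ N ℕ.* N ⟧) →
            B ℕ.* B ℕ.≤ 12 ℕ.* (N ℕ.* N ℕ.* N ℕ.* X) → c₀ * δ * δ * ⟦ N ⟧ ≤ ⟦ X ⟧
far⇒bound {δ} {zero} {B} {X} _ _ _ = begin
  c₀ * δ * δ * ⟦ 0 ⟧  ≡⟨ *-zeroʳ (c₀ * δ * δ) ⟩
  0ℚ                  ≤⟨ nonNegative⁻¹ ⟦ X ⟧ {{normalize-nonNeg X 1}} ⟩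
  ⟦ X ⟧               ∎
  where open ≤-Reasoning
far⇒bound {δ} {N@(suc _)} {B} {X} δ>0 far B²≤ = begin
  c₀ * δ * δ * ⟦ N ⟧        ≡⟨ solve 3 (λ c d n → c :* d :* d :* n := c :* (d :* d :* n)) refl c₀ δ ⟦ N ⟧ ⟩
  c₀ * (δ * δ * ⟦ N ⟧)      ≤⟨ *-monoˡ-≤-nonNeg c₀ {{normalize-nonNeg 1 12}} (far⇒δ²N≤12X {δ} {N} {B} {X} z<s δ>0 far B²≤) ⟩
  c₀ * (⟦ 12 ⟧ * ⟦ X ⟧)     ≡⟨ *-assoc c₀ ⟦ 12 ⟧ ⟦ X ⟧ ⟨
  1ℚ * ⟦ X ⟧                ≡⟨ *-identityˡ ⟦ X ⟧ ⟩
  ⟦ X ⟧                     ∎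
  where
  open ≤-Reasoning
  open +-*-Solver using (solve; _:*_; _:=_)

theorem1p7 :
  ∃[ c ] (0ℚ < c ×
    (∀ (N q : ℕ) (δ : ℚ) → 1 ℕ.≤ q → 0ℚ < δ →
     (T : Orientation N) → IsTournament T → DeltaFar δ T →
     (col : Colouring N q) → IsEdgeColouring col →
       (∃[ L ] ∃[ v ] (IsDirectedPath T L v × AtMostThreeColours col L v ×
          c * δ * δ * ⟦ N ⟧ ≤ ⟦ L ℕ.* q ^ 3 ⟧))
       ×
       (∃[ L ] ∃[ v ] (Distinct L v ×
          (∀ i → suc i ℕ.< L → T (v i) (v (suc i)) ≡ true) ×
          (∀ i → suc (suc i) ℕ.< L → T (v (suc (suc i))) (v i) ≡ true) ×
          (∀ i j → suc i ℕ.< L → suc j ℕ.< L → i % 3 ≡ j % 3 →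
             col (v i) (v (suc i)) ≡ col (v j) (v (suc j))) ×
          (∀ i j → suc (suc i) ℕ.< L → suc (suc j) ℕ.< L → i % 3 ≡ j % 3 →
             col (v i) (v (suc (suc i))) ≡ col (v j) (v (suc (suc j)))) ×
          c * δ * δ * ⟦ N ⟧ ≤ ⟦ L ℕ.* q ^ 3 ⟧))))
theorem1p7 = c₀ , c₀>0 , λ N q δ q≥1 δ>0 T tournament far col col-sym →
  let open Tournament T tournament using (ranking; ranking-isTournament; ranking-isTransitive)
      open Coloured T tournament col col-sym using (reversals⇒periodic-path; module PeriodicPath)
      far′ : ¬ (⟦ reversals T ranking ⟧ ≤ δ * ⟦ N ℕ.* N ⟧)
      far′ reversals≤ = far (ranking , ranking-isTournament , ranking-isTransitive , reversals≤)
      L , P , B²≤ = reversals⇒periodic-path q≥1 (far⇒n>0 {m = N ℕ.* N} δ>0 far′)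
      bound = far⇒bound {N = N} {B = reversals T ranking} {X = L ℕ.* q ^ 3} δ>0 far′ B²≤
      open PeriodicPath P
  in (L , vertex , directed , three-colours , bound) ,
     (L , vertex , distinct , forward , backward , forward-periodic , backward-periodic , bound)
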